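{- In the setting below, let $C=\{\{u,v\}\in E: u,v\in M_3\}$. Then $\mathbb{E}[|C|]\le q\rho c\,\mathbb{E}[|M_3|]$.
   Context: $G=(V,E)$ is a finite graph with a total order $\prec$ on $V$ witnessing inductive independence number $\rho\ge1$ (for every independent $S$ and every $v$, $|\{u\in S:u\succ v,\{u,v\}\in E\}|\le\rho$). Random subsets $V^I,V^S\subseteq V$ are chosen such that for each $v$ the pair of events $(v\in V^I,v\in V^S)$ is independent of those for other nodes (possibly correlated with each other), and $\frac1c\Pr[v\in V^S]\le\Pr[v\in V^I]\le c\Pr[v\in V^S]$ with a constant $c\ge1$. Sets are built as follows: $M_1$: go through $V^S$ in order $\prec$, adding $v$ if $M_1\cup\{v\}$ is independent. Then process the nodes of $V^I$ in some (adversarial) arrival order: $v$ is added to $M_2$ if there is no $u\in M_1$ with $u\prec v$ and $\{u,v\}\in E$; each $v\in M_2$ is added to $M_3$ independently with probability $q=\frac1{2\rho c}$.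
   Formalization: The joint probabilities of the events $v\in V^I$ and $v\in V^S$ for each node, and the constant $c$, are rational. -}

module Defs where

open import Data.Bool using (Bool; true; false; _∧_; not; if_then_else_)
open import Data.Nat as ℕ using (ℕ; zero; suc)
open import Data.Fin using (Fin; toℕ; _≟_)
open import Data.List using (List; []; _∷_; foldr; foldl; concatMap; map)
open import Data.Bool.ListAction using (any)
open import Data.List using () renaming (allFin to allFinL)
open import Data.Vec.Functional using () renaming (_∷_ to _◂_)
open import Data.Integer using (+_)
open import Data.Rational using (ℚ; 0ℚ; 1ℚ; _+_; _*_; _-_; _/_)
open import Relation.Binary.PropositionalEquality using (_≡_)
open import Relation.Nullary.Decidable using (⌊_⌋)

-- A finite simple graph on the vertex set Fin n.  The total order ≺ witnessing
-- inductive independence is taken to be the natural order on Fin n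
-- (w.l.o.g., by relabelling the vertices).
record Graph (n : ℕ) : Set where
  field
    adj    : Fin n → Fin n → Bool
    sym    : ∀ u v → adj u v ≡ adj v u
    irrefl : ∀ v → adj v v ≡ false
open Graph public

_≺_ : ∀ {n} → Fin n → Fin n → Bool
u ≺ v = toℕ u ℕ.<ᵇ toℕ v

Subset : ℕ → Set
Subset n = Fin n → Bool

count : ∀ {n} → (Fin n → Bool) → ℕ
count {n} P = foldr (λ v k → if P v then suc k else k) 0 (allFinL n)

Independent : ∀ {n} → Graph n → Subset n → Set
Independent G S = ∀ u v → S u ≡ true → S v ≡ true → adj G u v ≡ false

InductivelyIndependent : ∀ {n} → Graph n → ℕ → Set
InductivelyIndependent {n} G ρ =
  (S : Subset n) → Independent G S → (v : Fin n) →
  count (λ u → S u ∧ (v ≺ u) ∧ adj G u v) ℕ.≤ ρ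

greedyList : ∀ {n} → Graph n → Subset n → List (Fin n)
greedyList {n} G VS = foldl step [] (allFinL n)
  where
  step : List (Fin n) → Fin n → List (Fin n)
  step acc v = if VS v ∧ not (any (λ u → adj G u v) acc) then v ∷ acc else acc

M₁ : ∀ {n} → Graph n → Subset n → Subset n
M₁ G VS v = any (λ u → ⌊ u ≟ v ⌋) (greedyList G VS)

-- M₂: nodes of V^I with no earlier neighbour in M₁ (independent of arrival order)
M₂ : ∀ {n} → Graph n → Subset n → Subset n → Subset n
M₂ {n} G VS VI v =
  VI v ∧ not (any (λ u → M₁ G VS u ∧ (u ≺ v) ∧ adj G u v) (allFinL n))

M₃ : ∀ {n} → Graph n → Subset n → Subset n → Subset n → Subset n
M₃ G VS VI coin v = M₂ G VS VI v ∧ coin v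

sizeC : ∀ {n} → Graph n → Subset n → Subset n → Subset n → ℕ
sizeC {n} G VS VI coin =
  foldr ℕ._+_ 0 (map (λ v → count (λ u → (u ≺ v) ∧ adj G u v ∧ M₃ G VS VI coin u ∧ M₃ G VS VI coin v)) (allFinL n))

sizeM₃ : ∀ {n} → Graph n → Subset n → Subset n → Subset n → ℕ
sizeM₃ G VS VI coin = count (M₃ G VS VI coin)

allSubsets : (n : ℕ) → List (Subset n)
allSubsets zero = (λ ()) ∷ []
allSubsets (suc n) = concatMap (λ f → (false ◂ f) ∷ (true ◂ f) ∷ []) (allSubsets n)

ℕtoℚ : ℕ → ℚ
ℕtoℚ k = (+ k) / 1

sumℚ : List ℚ → ℚ
sumℚ = foldr _+_ 0ℚ

prodℚ : ∀ {n} → (Fin n → ℚ) → ℚ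
prodℚ {n} f = foldr (λ v r → f v * r) 1ℚ (allFinL n)

-- Per-node joint law of the pair of events (v ∈ V^I , v ∈ V^S):
-- JointLaw n = λ v a b → Pr[(v∈V^I) = a ∧ (v∈V^S) = b]; nodes are independent.
JointLaw : ℕ → Set
JointLaw n = Fin n → Bool → Bool → ℚ

PrI : ∀ {n} → JointLaw n → Fin n → ℚ
PrI p v = p v true false + p v true true

PrS : ∀ {n} → JointLaw n → Fin n → ℚ
PrS p v = p v false true + p v true true

weight : ∀ {n} → JointLaw n → ℚ → Subset n → Subset n → Subset n → ℚ
weight p q VI VS coin =
  prodℚ (λ v → p v (VI v) (VS v) * (if coin v then q else 1ℚ - q))

𝔼 : ∀ {n} → JointLaw n → ℚ → (Subset n → Subset n → Subset n → ℕ) → ℚ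
𝔼 {n} p q X =
  sumℚ (concatMap (λ VI → concatMap (λ VS → map (λ coin →
    weight p q VI VS coin * ℕtoℚ (X VI VS coin)) (allSubsets n)) (allSubsets n)) (allSubsets n))

-- Fix an edge u ≺ v of C.  Both endpoints lie in M₃, so v ∈ V^I, v's coin came up, v has no
-- earlier neighbour in M₁, and u ∈ M₃.  The last two facts only involve the randomness of the
-- nodes other than v: M₁ restricted to nodes before v is decided by V^S before v.  By
-- independence of the nodes, trading v's own event "v ∈ V^I and its coin is heads" (probability
-- q·Pr[v ∈ V^I]) for "v ∈ V^S" (probability Pr[v ∈ V^S] ≥ Pr[v ∈ V^I]/c) costs a factor c·q,
-- and "v ∈ V^S with no earlier M₁-neighbour" says exactly that v ∈ M₁.  Charging the edge to u,
-- E|C| ≤ c·q·E #{(u, v) : u ∈ M₃, v ∈ M₁, u ≺ v, {u, v} ∈ E}, and as M₁ is independent,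
-- inductive independence leaves at most ρ such v for every u.

module Submission where

open import Defs
open import Data.Bool using (Bool; true; false)
open import Data.Nat using (ℕ)
open import Data.Fin using (Fin)
open import Data.Rational using (ℚ; 0ℚ; 1ℚ; _+_; _*_; _≤_)
open import Relation.Binary.PropositionalEquality using (_≡_)

open import Algebra.Bundles using (CommutativeMonoid)
import Algebra.Properties.CommutativeSemigroup as CommutativeSemigroupProperties
open import Data.Bool using (_∧_; not; if_then_else_; T)
open import Data.Bool.ListAction using (any; or)
open import Data.Bool.Properties
  using (T-∧; T-≡; T-not-≡; ⇔→≡; ∧-zeroʳ; ∧-identityʳ; ∧-assoc; ∧-commutativeMonoid)
open import Data.Empty using (⊥-elim)
open import Data.Fin as Fin using (zero; suc; toℕ; _<_)
open import Data.Fin.Induction using (<-wellFounded)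
import Data.Fin.Properties as Finₚ
open import Data.Integer as ℤ using () renaming (+_ to ⁺)
import Data.Integer.Properties as ℤ
open import Data.List using (List; []; _∷_; map; concatMap; foldr; foldl; _++_; allFin; tabulate)
import Data.List.Properties as List
open import Data.List.Membership.Propositional using (_∈_; _∉_; lose; find)
open import Data.List.Membership.Propositional.Properties using (∈-allFin)
open import Data.List.Relation.Unary.All using (All)
import Data.List.Relation.Unary.All as All
open import Data.List.Relation.Unary.AllPairs using (AllPairs; _∷_)
open import Data.List.Relation.Unary.AllPairs.Properties using (tabulate⁺-<)
open import Data.List.Relation.Unary.Any using (here; there)
import Data.List.Relation.Unary.Any as Any
open import Data.List.Relation.Unary.Any.Properties using (any⁺; any⁻)
open import Data.Nat as ℕ using (suc)
import Data.Nat.Coprimality as Coprime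
import Data.Nat.Properties as ℕ
open import Data.Product using (_×_; _,_; proj₁; proj₂; ∃-syntax)
open import Data.Rational using (_-_; -_; *≤*; nonNegative; mkℚ)
open import Data.Rational.Properties
  using ( ≤-refl; ≤-trans; ≤-total; +-mono-≤; +-monoˡ-≤; *-monoˡ-≤-nonNeg; *-monoʳ-≤-nonNeg
        ; nonNegative⁻¹; nonNeg*nonNeg⇒nonNeg; ↥p/↧p≡p; /-cong
        ; +-assoc; +-identityˡ; +-identityʳ; +-inverseʳ; *-assoc; *-comm; *-identityˡ; *-identityʳ
        ; *-zeroˡ; *-zeroʳ; *-distribˡ-+; *-distribʳ-+
        ; +-0-commutativeMonoid; *-1-commutativeMonoid; module ≤-Reasoning )
open import Data.Rational.Solver using (module +-*-Solver)
open +-*-Solver using (solve; _:+_; _:*_; _:-_; con; _:=_)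
open import Data.Sum using (_⊎_; inj₁; inj₂)
open import Data.Unit using (tt)
open import Data.Vec.Functional using (tail) renaming (_∷_ to _◂_)
open import Function using (id; _∘_; Equivalence; mk⇔)
open import Induction.WellFounded using (Acc; acc)
open import Relation.Binary.PropositionalEquality as ≡
  using (_≢_; refl; cong; cong₂; subst; subst₂; trans; module ≡-Reasoning)
open import Relation.Nullary using (¬_; contradiction)
open import Relation.Nullary.Decidable using (fromWitness; toWitness)

private
  module +-Props = CommutativeSemigroupProperties (CommutativeMonoid.commutativeSemigroup +-0-commutativeMonoid)
  module *-Props = CommutativeSemigroupProperties (CommutativeMonoid.commutativeSemigroup *-1-commutativeMonoid)
  module ∧-Props = CommutativeSemigroupProperties (CommutativeMonoid.commutativeSemigroup ∧-commutativeMonoid)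

0≤1 : 0ℚ ≤ 1ℚ
0≤1 = *≤* (ℤ.+≤+ ℕ.z≤n)

*-nonNeg : ∀ {x y} → 0ℚ ≤ x → 0ℚ ≤ y → 0ℚ ≤ x * y
*-nonNeg {x} {y} 0≤x 0≤y =
  nonNegative⁻¹ (x * y) {{nonNeg*nonNeg⇒nonNeg x {{nonNegative 0≤x}} y {{nonNegative 0≤y}}}}

*-monoˡ-≤-0≤ : ∀ {k x y} → 0ℚ ≤ k → x ≤ y → k * x ≤ k * y
*-monoˡ-≤-0≤ {k} 0≤k = *-monoˡ-≤-nonNeg k {{nonNegative 0≤k}}

*-monoʳ-≤-0≤ : ∀ {k x y} → 0ℚ ≤ k → x ≤ y → x * k ≤ y * k
*-monoʳ-≤-0≤ {k} 0≤k = *-monoʳ-≤-nonNeg k {{nonNegative 0≤k}}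

1≤* : ∀ {x y} → 1ℚ ≤ x → 1ℚ ≤ y → 1ℚ ≤ x * y
1≤* {x} {y} 1≤x 1≤y =
  ≤-trans 1≤x (subst (_≤ x * y) (*-identityʳ x) (*-monoˡ-≤-0≤ {x} (≤-trans 0≤1 1≤x) 1≤y))

inverse-nonNeg : ∀ {x y} → 1ℚ ≤ y → x * y ≡ 1ℚ → 0ℚ ≤ x
inverse-nonNeg {x} {y} 1≤y xy≡1 with ≤-total 0ℚ x
... | inj₁ 0≤x = 0≤x
... | inj₂ x≤0 =
  contradiction (subst₂ _≤_ xy≡1 (*-zeroˡ y) (*-monoʳ-≤-0≤ (≤-trans 0≤1 1≤y) x≤0)) 1≰0
  where
  1≰0 : ¬ 1ℚ ≤ 0ℚ
  1≰0 (*≤* (ℤ.+≤+ ()))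

inverse-≤1 : ∀ {x y} → 1ℚ ≤ y → x * y ≡ 1ℚ → x ≤ 1ℚ
inverse-≤1 {x} 1≤y xy≡1 =
  subst₂ _≤_ (*-identityʳ x) xy≡1 (*-monoˡ-≤-0≤ {x} (inverse-nonNeg 1≤y xy≡1) 1≤y)

0≤1-x : ∀ {x} → x ≤ 1ℚ → 0ℚ ≤ 1ℚ - x
0≤1-x {x} x≤1 = subst (_≤ 1ℚ - x) (+-inverseʳ x) (+-monoˡ-≤ (- x) x≤1)

ℕtoℚ≡mkℚ : ∀ k → ℕtoℚ k ≡ mkℚ (⁺ k) 0 (Coprime.sym (Coprime.1-coprimeTo k))
ℕtoℚ≡mkℚ k = ↥p/↧p≡p (mkℚ (⁺ k) 0 (Coprime.sym (Coprime.1-coprimeTo k)))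

-- 1ℚ + mkℚ (⁺ k) 0 _ unfolds to (1·1 + k·1) / (1·1).
ℕtoℚ-suc : ∀ k → ℕtoℚ (suc k) ≡ 1ℚ + ℕtoℚ k
ℕtoℚ-suc k = trans (/-cong {p₂ = ⁺ 1 ℤ.* ⁺ 1 ℤ.+ ⁺ k ℤ.* ⁺ 1} {q₂ = 1 ℕ.* 1} numerator refl)
                   (cong (1ℚ +_) (≡.sym (ℕtoℚ≡mkℚ k)))
  where
  numerator : ⁺ (suc k) ≡ ⁺ 1 ℤ.* ⁺ 1 ℤ.+ ⁺ k ℤ.* ⁺ 1
  numerator = cong (ℤ._+_ (⁺ 1)) (≡.sym (ℤ.*-identityʳ (⁺ k)))

ℕtoℚ-+ : ∀ a b → ℕtoℚ (a ℕ.+ b) ≡ ℕtoℚ a + ℕtoℚ b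
ℕtoℚ-+ ℕ.zero    b = ≡.sym (+-identityˡ (ℕtoℚ b))
ℕtoℚ-+ (suc a) b = begin
  ℕtoℚ (suc (a ℕ.+ b))    ≡⟨ ℕtoℚ-suc (a ℕ.+ b) ⟩
  1ℚ + ℕtoℚ (a ℕ.+ b)     ≡⟨ cong (1ℚ +_) (ℕtoℚ-+ a b) ⟩
  1ℚ + (ℕtoℚ a + ℕtoℚ b)  ≡⟨ ≡.sym (+-assoc 1ℚ (ℕtoℚ a) (ℕtoℚ b)) ⟩
  (1ℚ + ℕtoℚ a) + ℕtoℚ b  ≡⟨ cong (_+ ℕtoℚ b) (≡.sym (ℕtoℚ-suc a)) ⟩
  ℕtoℚ (suc a) + ℕtoℚ b   ∎
  where open ≡-Reasoning

ℕtoℚ-mono-≤ : ∀ {a b} → a ℕ.≤ b → ℕtoℚ a ≤ ℕtoℚ b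
ℕtoℚ-mono-≤ {a} {b} a≤b rewrite ℕtoℚ≡mkℚ a | ℕtoℚ≡mkℚ b =
  *≤* (ℤ.*-monoʳ-≤-nonNeg (⁺ 1) (ℤ.+≤+ a≤b))

𝟙 : Bool → ℚ
𝟙 true  = 1ℚ
𝟙 false = 0ℚ

𝟙-nonNeg : ∀ b → 0ℚ ≤ 𝟙 b
𝟙-nonNeg true  = 0≤1
𝟙-nonNeg false = ≤-refl

𝟙-∧ : ∀ a b → 𝟙 (a ∧ b) ≡ 𝟙 a * 𝟙 b
𝟙-∧ true  b = ≡.sym (*-identityˡ (𝟙 b))
𝟙-∧ false b = ≡.sym (*-zeroˡ (𝟙 b))

variable
  A B : Set

∑ : List A → (A → ℚ) → ℚ
∑ xs f = sumℚ (map f xs)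

∑-cong : ∀ xs {f g : A → ℚ} → (∀ x → f x ≡ g x) → ∑ xs f ≡ ∑ xs g
∑-cong []       f≗g = refl
∑-cong (x ∷ xs) f≗g = cong₂ _+_ (f≗g x) (∑-cong xs f≗g)

∑-0 : ∀ (xs : List A) → ∑ xs (λ _ → 0ℚ) ≡ 0ℚ
∑-0 []       = refl
∑-0 (x ∷ xs) = trans (+-identityˡ _) (∑-0 xs)

∑-+ : ∀ xs (f g : A → ℚ) → ∑ xs (λ x → f x + g x) ≡ ∑ xs f + ∑ xs g
∑-+ []       f g = ≡.sym (+-identityˡ 0ℚ)
∑-+ (x ∷ xs) f g = trans (cong (f x + g x +_) (∑-+ xs f g)) (+-Props.interchange (f x) (g x) _ _)

∑-*ˡ : ∀ xs k (f : A → ℚ) → ∑ xs (λ x → k * f x) ≡ k * ∑ xs f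
∑-*ˡ []       k f = ≡.sym (*-zeroʳ k)
∑-*ˡ (x ∷ xs) k f = trans (cong (k * f x +_) (∑-*ˡ xs k f)) (≡.sym (*-distribˡ-+ k (f x) _))

∑-mono : ∀ xs {f g : A → ℚ} → (∀ x → f x ≤ g x) → ∑ xs f ≤ ∑ xs g
∑-mono []       f≤g = ≤-refl
∑-mono (x ∷ xs) f≤g = +-mono-≤ (f≤g x) (∑-mono xs f≤g)

∑-swap : ∀ xs (ys : List B) (f : A → B → ℚ) →
         ∑ xs (λ x → ∑ ys (f x)) ≡ ∑ ys (λ y → ∑ xs (λ x → f x y))
∑-swap []       ys f = ≡.sym (∑-0 ys)
∑-swap (x ∷ xs) ys f = trans (cong (∑ ys (f x) +_) (∑-swap xs ys f)) (≡.sym (∑-+ ys (f x) _))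

∑²-*ˡ : ∀ xs (ys : List B) k (f : A → B → ℚ) →
        (∑ xs λ x → ∑ ys λ y → k * f x y) ≡ k * ∑ xs λ x → ∑ ys (f x)
∑²-*ˡ xs ys k f = trans (∑-cong xs λ x → ∑-*ˡ ys k (f x)) (∑-*ˡ xs k λ x → ∑ ys (f x))

sumℚ-++ : ∀ xs ys → sumℚ (xs ++ ys) ≡ sumℚ xs + sumℚ ys
sumℚ-++ []       ys = ≡.sym (+-identityˡ _)
sumℚ-++ (x ∷ xs) ys = trans (cong (x +_) (sumℚ-++ xs ys)) (≡.sym (+-assoc x _ _))

sumℚ-concatMap : ∀ xs (h : A → List ℚ) → sumℚ (concatMap h xs) ≡ ∑ xs (sumℚ ∘ h)
sumℚ-concatMap []       h = refl
sumℚ-concatMap (x ∷ xs) h = trans (sumℚ-++ (h x) _) (cong (sumℚ (h x) +_) (sumℚ-concatMap xs h))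

∑-concatMap : ∀ xs (h : A → List B) (f : B → ℚ) → ∑ (concatMap h xs) f ≡ ∑ xs (λ x → ∑ (h x) f)
∑-concatMap xs h f = trans (cong sumℚ (List.map-concatMap f h xs)) (sumℚ-concatMap xs (map f ∘ h))

ℕtoℚ-count : ∀ {n} (P : Fin n → Bool) → ℕtoℚ (count P) ≡ ∑ (allFin n) (𝟙 ∘ P)
ℕtoℚ-count {n} P = go (allFin n)
  where
  go : ∀ vs → ℕtoℚ (foldr (λ v k → if P v then suc k else k) 0 vs) ≡ ∑ vs (𝟙 ∘ P)
  go []       = refl
  go (v ∷ vs) with P v
  ... | true  = trans (ℕtoℚ-suc (foldr (λ v k → if P v then suc k else k) 0 vs)) (cong (1ℚ +_) (go vs))
  ... | false = trans (go vs) (≡.sym (+-identityˡ _))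

ℕtoℚ-sum : ∀ xs (h : A → ℕ) → ℕtoℚ (foldr ℕ._+_ 0 (map h xs)) ≡ ∑ xs (ℕtoℚ ∘ h)
ℕtoℚ-sum []       h = refl
ℕtoℚ-sum (x ∷ xs) h = trans (ℕtoℚ-+ (h x) _) (cong (ℕtoℚ (h x) +_) (ℕtoℚ-sum xs h))

∑𝔹 : (Bool → ℚ) → ℚ
∑𝔹 g = g false + g true

∑𝔹³ : (Bool → Bool → Bool → ℚ) → ℚ
∑𝔹³ g = ∑𝔹 λ a → ∑𝔹 λ b → ∑𝔹 λ d → g a b d

∑𝔹-cong : ∀ {g h : Bool → ℚ} → (∀ a → g a ≡ h a) → ∑𝔹 g ≡ ∑𝔹 h
∑𝔹-cong g≗h = cong₂ _+_ (g≗h false) (g≗h true)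

∑𝔹³-cong : ∀ {g h : Bool → Bool → Bool → ℚ} → (∀ a b d → g a b d ≡ h a b d) → ∑𝔹³ g ≡ ∑𝔹³ h
∑𝔹³-cong g≗h = ∑𝔹-cong λ a → ∑𝔹-cong λ b → ∑𝔹-cong λ d → g≗h a b d

∑𝔹-*ˡ : ∀ k (g : Bool → ℚ) → ∑𝔹 (λ a → k * g a) ≡ k * ∑𝔹 g
∑𝔹-*ˡ k g = ≡.sym (*-distribˡ-+ k (g false) (g true))

∑𝔹-*ʳ : ∀ k (g : Bool → ℚ) → ∑𝔹 (λ a → g a * k) ≡ ∑𝔹 g * k
∑𝔹-*ʳ k g = ≡.sym (*-distribʳ-+ k (g false) (g true))

∑𝔹³-*ˡ : ∀ k (g : Bool → Bool → Bool → ℚ) → ∑𝔹³ (λ a b d → k * g a b d) ≡ k * ∑𝔹³ g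
∑𝔹³-*ˡ k g =
  trans (∑𝔹-cong λ a → trans (∑𝔹-cong λ b → ∑𝔹-*ˡ k (g a b)) (∑𝔹-*ˡ k λ b → ∑𝔹 (g a b)))
  (∑𝔹-*ˡ k λ a → ∑𝔹 λ b → ∑𝔹 (g a b))

∑𝔹³-*ʳ : ∀ k (g : Bool → Bool → Bool → ℚ) → ∑𝔹³ (λ a b d → g a b d * k) ≡ ∑𝔹³ g * k
∑𝔹³-*ʳ k g = trans (∑𝔹³-cong λ a b d → *-comm (g a b d) k) (trans (∑𝔹³-*ˡ k g) (*-comm k _))

∑-∑𝔹 : ∀ xs (g : A → Bool → ℚ) → ∑ xs (λ x → ∑𝔹 (g x)) ≡ ∑𝔹 (λ a → ∑ xs (λ x → g x a))
∑-∑𝔹 xs g = ∑-+ xs (λ x → g x false) (λ x → g x true)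

∑-∑𝔹² : ∀ xs (g : A → Bool → Bool → ℚ) →
        ∑ xs (λ x → ∑𝔹 λ a → ∑𝔹 (g x a)) ≡ ∑𝔹 (λ a → ∑𝔹 λ b → ∑ xs (λ x → g x a b))
∑-∑𝔹² xs g = trans (∑-∑𝔹 xs λ x a → ∑𝔹 (g x a)) (∑𝔹-cong λ a → ∑-∑𝔹 xs λ x → g x a)

∑-∑𝔹³ : ∀ xs (g : A → Bool → Bool → Bool → ℚ) →
        ∑ xs (λ x → ∑𝔹³ (g x)) ≡ ∑𝔹³ (λ a b d → ∑ xs (λ x → g x a b d))
∑-∑𝔹³ xs g =
  trans (∑-∑𝔹 xs λ x a → ∑𝔹 λ b → ∑𝔹 (g x a b)) (∑𝔹-cong λ a → ∑-∑𝔹² xs λ x → g x a)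

∑-allSubsets-suc : ∀ {n} (f : Subset (suc n) → ℚ) →
                   ∑ (allSubsets (suc n)) f ≡ ∑ (allSubsets n) (λ S → ∑𝔹 λ a → f (a ◂ S))
∑-allSubsets-suc {n} f = trans (∑-concatMap (allSubsets n) _ f)
  (∑-cong (allSubsets n) λ S → cong (f (false ◂ S) +_) (+-identityʳ (f (true ◂ S))))

prodℚ-suc : ∀ {n} (f : Fin (suc n) → ℚ) → prodℚ f ≡ f zero * prodℚ (f ∘ suc)
prodℚ-suc {n} f = cong (f zero *_) (begin
  foldr (λ v r → f v * r) 1ℚ (tabulate Fin.suc)
    ≡⟨ cong (foldr (λ v r → f v * r) 1ℚ) (≡.sym (List.map-tabulate {n = n} id Fin.suc)) ⟩
  foldr (λ v r → f v * r) 1ℚ (map Fin.suc (allFin n))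
    ≡⟨ List.foldr-map (λ v r → f v * r) Fin.suc 1ℚ (allFin n) ⟩
  foldr (λ v r → f (suc v) * r) 1ℚ (allFin n)  ∎)
  where open ≡-Reasoning

RandomVar : ℕ → Set
RandomVar n = Subset n → Subset n → Subset n → ℚ

E : ∀ {n} → JointLaw n → ℚ → RandomVar n → ℚ
E {n} p q X = ∑ (allSubsets n) λ VI → ∑ (allSubsets n) λ VS → ∑ (allSubsets n) λ coin →
  weight p q VI VS coin * X VI VS coin

𝔼≡E : ∀ {n} (p : JointLaw n) q X → 𝔼 p q X ≡ E p q (λ VI VS coin → ℕtoℚ (X VI VS coin))
𝔼≡E {n} p q X = trans (sumℚ-concatMap (allSubsets n) _)
  (∑-cong (allSubsets n) λ VI → sumℚ-concatMap (allSubsets n) _)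

module _ {n} (p : JointLaw n) (q : ℚ) where

  private
    Ω = allSubsets n

  E-cong : ∀ {X Y : RandomVar n} → (∀ VI VS coin → X VI VS coin ≡ Y VI VS coin) → E p q X ≡ E p q Y
  E-cong X≗Y = ∑-cong Ω λ VI → ∑-cong Ω λ VS → ∑-cong Ω λ coin →
    cong (weight p q VI VS coin *_) (X≗Y VI VS coin)

  E-0 : E p q (λ _ _ _ → 0ℚ) ≡ 0ℚ
  E-0 = trans (∑-cong Ω λ VI → trans (∑-cong Ω λ VS → trans (∑-cong Ω λ coin → *-zeroʳ (weight p q VI VS coin))
                (∑-0 Ω)) (∑-0 Ω)) (∑-0 Ω)

  E-+ : ∀ X Y → E p q (λ VI VS coin → X VI VS coin + Y VI VS coin) ≡ E p q X + E p q Y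
  E-+ X Y = trans (∑-cong Ω λ VI → trans (∑-cong Ω λ VS → trans (∑-cong Ω λ coin →
                *-distribˡ-+ (weight p q VI VS coin) _ _) (∑-+ Ω _ _)) (∑-+ Ω _ _)) (∑-+ Ω _ _)

  E-*ˡ : ∀ k X → E p q (λ VI VS coin → k * X VI VS coin) ≡ k * E p q X
  E-*ˡ k X = trans (∑-cong Ω λ VI → trans (∑-cong Ω λ VS → trans (∑-cong Ω λ coin →
                *-Props.x∙yz≈y∙xz (weight p q VI VS coin) k _) (∑-*ˡ Ω k _)) (∑-*ˡ Ω k _)) (∑-*ˡ Ω k _)

  E-∑ : ∀ xs (X : A → RandomVar n) →
        E p q (λ VI VS coin → ∑ xs λ x → X x VI VS coin) ≡ ∑ xs λ x → E p q (X x)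
  E-∑ []       X = E-0
  E-∑ (x ∷ xs) X = trans (E-+ (X x) _) (cong (E p q (X x) +_) (E-∑ xs X))

E-∑² : ∀ {n} (p : JointLaw n) q xs (ys : List B) (X : A → B → RandomVar n) →
       E p q (λ VI VS coin → ∑ xs λ x → ∑ ys λ y → X x y VI VS coin)
         ≡ ∑ xs λ x → ∑ ys λ y → E p q (X x y)
E-∑² p q xs ys X = trans (E-∑ p q xs λ x VI VS coin → ∑ ys λ y → X x y VI VS coin)
                         (∑-cong xs λ x → E-∑ p q ys (X x))

coinWeight : ℚ → Bool → ℚ
coinWeight q d = if d then q else 1ℚ - q

nodeWeight : ∀ {n} → JointLaw n → ℚ → Fin n → Bool → Bool → Bool → ℚ
nodeWeight p q v a b d = p v a b * coinWeight q d

tailLaw : ∀ {n} → JointLaw (suc n) → JointLaw n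
tailLaw p = p ∘ suc

fixFirst : ∀ {n} → RandomVar (suc n) → Bool → Bool → Bool → RandomVar n
fixFirst X a b d VI VS coin = X (a ◂ VI) (b ◂ VS) (d ◂ coin)

weight-suc : ∀ {n} (p : JointLaw (suc n)) q VI VS coin →
             weight p q VI VS coin ≡
             nodeWeight p q zero (VI zero) (VS zero) (coin zero) * weight (tailLaw p) q (tail VI) (tail VS) (tail coin)
weight-suc p q VI VS coin = prodℚ-suc (λ v → nodeWeight p q v (VI v) (VS v) (coin v))

module _ {m} (p : JointLaw (suc m)) (q : ℚ) where

  private
    Ω = allSubsets m
    w₀ = nodeWeight p q zero

  E-split : ∀ X → E p q X ≡
    ∑ Ω λ VI → ∑𝔹 λ a → ∑ Ω λ VS → ∑𝔹 λ b → ∑ Ω λ coin → ∑𝔹 λ d →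
      weight (tailLaw p) q VI VS coin * (w₀ a b d * fixFirst X a b d VI VS coin)
  E-split X =
    trans (∑-allSubsets-suc λ VI → ∑ Ω′ λ VS → ∑ Ω′ λ coin → weight p q VI VS coin * X VI VS coin)
          (∑-cong Ω λ VI → ∑𝔹-cong λ a →
    trans (∑-allSubsets-suc λ VS → ∑ Ω′ λ coin → weight p q (a ◂ VI) VS coin * X (a ◂ VI) VS coin)
          (∑-cong Ω λ VS → ∑𝔹-cong λ b →
    trans (∑-allSubsets-suc λ coin → weight p q (a ◂ VI) (b ◂ VS) coin * X (a ◂ VI) (b ◂ VS) coin)
          (∑-cong Ω λ coin → ∑𝔹-cong λ d → begin
      weight p q (a ◂ VI) (b ◂ VS) (d ◂ coin) * X (a ◂ VI) (b ◂ VS) (d ◂ coin)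
        ≡⟨ cong (_* X (a ◂ VI) (b ◂ VS) (d ◂ coin)) (weight-suc p q (a ◂ VI) (b ◂ VS) (d ◂ coin)) ⟩
      w₀ a b d * W VI VS coin * X (a ◂ VI) (b ◂ VS) (d ◂ coin)
        ≡⟨ *-Props.xy∙z≈y∙xz (w₀ a b d) (W VI VS coin) _ ⟩
      W VI VS coin * (w₀ a b d * X (a ◂ VI) (b ◂ VS) (d ◂ coin))  ∎)))
    where
    open ≡-Reasoning
    Ω′ = allSubsets (suc m)
    W = weight (tailLaw p) q

  E-peel : ∀ X → E p q X ≡ ∑𝔹³ λ a b d → w₀ a b d * E (tailLaw p) q (fixFirst X a b d)
  E-peel X = begin
    E p q X
      ≡⟨ E-split X ⟩
    (∑ Ω λ VI → ∑𝔹 λ a → ∑ Ω λ VS → ∑𝔹 λ b → ∑ Ω λ coin → ∑𝔹 λ d → H a b d VI VS coin)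
      ≡⟨ ∑-cong Ω (λ VI → ∑𝔹-cong λ a → ∑-cong Ω λ VS → ∑𝔹-cong λ b →
           ∑-∑𝔹 Ω λ coin d → H a b d VI VS coin) ⟩
    (∑ Ω λ VI → ∑𝔹 λ a → ∑ Ω λ VS → ∑𝔹 λ b → ∑𝔹 λ d → ∑ Ω λ coin → H a b d VI VS coin)
      ≡⟨ ∑-cong Ω (λ VI → ∑𝔹-cong λ a → ∑-∑𝔹² Ω λ VS b d → ∑ Ω λ coin → H a b d VI VS coin) ⟩
    (∑ Ω λ VI → ∑𝔹 λ a → ∑𝔹 λ b → ∑𝔹 λ d → ∑ Ω λ VS → ∑ Ω λ coin → H a b d VI VS coin)
      ≡⟨ ∑-∑𝔹³ Ω (λ VI a b d → ∑ Ω λ VS → ∑ Ω λ coin → H a b d VI VS coin) ⟩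
    (∑𝔹³ λ a b d → E (tailLaw p) q λ VI VS coin → w₀ a b d * fixFirst X a b d VI VS coin)
      ≡⟨ ∑𝔹³-cong (λ a b d → E-*ˡ (tailLaw p) q (w₀ a b d) (fixFirst X a b d)) ⟩
    (∑𝔹³ λ a b d → w₀ a b d * E (tailLaw p) q (fixFirst X a b d))  ∎
    where
    open ≡-Reasoning
    H : Bool → Bool → Bool → RandomVar m
    H a b d VI VS coin = weight (tailLaw p) q VI VS coin * (w₀ a b d * fixFirst X a b d VI VS coin)

prodℚ-nonNeg : ∀ {n} {f : Fin n → ℚ} → (∀ v → 0ℚ ≤ f v) → 0ℚ ≤ prodℚ f
prodℚ-nonNeg {n} {f} 0≤f = go (allFin n)
  where
  go : ∀ vs → 0ℚ ≤ foldr (λ v r → f v * r) 1ℚ vs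
  go []       = 0≤1
  go (v ∷ vs) = *-nonNeg (0≤f v) (go vs)

NonNegativeWeights : ∀ {n} → JointLaw n → ℚ → Set
NonNegativeWeights p q = ∀ v a b d → 0ℚ ≤ nodeWeight p q v a b d

module _ {n} {p : JointLaw n} {q : ℚ} (0≤w : NonNegativeWeights p q) where

  private
    Ω = allSubsets n

  weight-nonNeg : ∀ VI VS coin → 0ℚ ≤ weight p q VI VS coin
  weight-nonNeg VI VS coin = prodℚ-nonNeg λ v → 0≤w v (VI v) (VS v) (coin v)

  E-mono : ∀ {X Y : RandomVar n} → (∀ VI VS coin → X VI VS coin ≤ Y VI VS coin) → E p q X ≤ E p q Y
  E-mono X≤Y = ∑-mono Ω λ VI → ∑-mono Ω λ VS → ∑-mono Ω λ coin →
    *-monoˡ-≤-0≤ (weight-nonNeg VI VS coin) (X≤Y VI VS coin)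

  E-nonNeg : ∀ {X : RandomVar n} → (∀ VI VS coin → 0ℚ ≤ X VI VS coin) → 0ℚ ≤ E p q X
  E-nonNeg {X} 0≤X = subst (_≤ E p q X) (E-0 p q) (E-mono 0≤X)

nodeWeight-nonNeg : ∀ {n} {p : JointLaw n} {q} → (∀ v a b → 0ℚ ≤ p v a b) → 0ℚ ≤ q → q ≤ 1ℚ →
                    NonNegativeWeights p q
nodeWeight-nonNeg 0≤p 0≤q q≤1 v a b true  = *-nonNeg (0≤p v a b) 0≤q
nodeWeight-nonNeg 0≤p 0≤q q≤1 v a b false = *-nonNeg (0≤p v a b) (0≤1-x q≤1)

nodeMean : ∀ {n} → JointLaw n → ℚ → Fin n → (Bool → Bool → Bool → ℚ) → ℚ
nodeMean p q v f = ∑𝔹³ λ a b d → nodeWeight p q v a b d * f a b d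

Normalised : ∀ {n} → JointLaw n → ℚ → Set
Normalised p q = ∀ v → nodeMean p q v (λ _ _ _ → 1ℚ) ≡ 1ℚ

AgreeOff : ∀ {n} → Fin n → Subset n → Subset n → Set
AgreeOff v S T = ∀ u → u ≢ v → S u ≡ T u

IgnoresNode : ∀ {n} → Fin n → RandomVar n → Set
IgnoresNode v X = ∀ {VI VS coin VI′ VS′ coin′} →
  AgreeOff v VI VI′ → AgreeOff v VS VS′ → AgreeOff v coin coin′ → X VI VS coin ≡ X VI′ VS′ coin′

agreeOff-zero : ∀ {n} a b (S : Subset n) → AgreeOff zero (a ◂ S) (b ◂ S)
agreeOff-zero a b S zero    0≢0 = contradiction refl 0≢0
agreeOff-zero a b S (suc u) _   = refl

agreeOff-suc : ∀ {n} {v : Fin n} a {S T} → AgreeOff v S T → AgreeOff (suc v) (a ◂ S) (a ◂ T)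
agreeOff-suc a S≈T zero    _   = refl
agreeOff-suc a S≈T (suc u) u≢v = S≈T u (u≢v ∘ cong suc)

module _ {m} {X : RandomVar (suc m)} where

  fixFirst-ignored : IgnoresNode zero X → ∀ a b d VI VS coin →
                     fixFirst X a b d VI VS coin ≡ fixFirst X false false false VI VS coin
  fixFirst-ignored ignores a b d VI VS coin =
    ignores (agreeOff-zero a false VI) (agreeOff-zero b false VS) (agreeOff-zero d false coin)

  fixFirst-ignores : ∀ {v} → IgnoresNode (suc v) X → ∀ a b d → IgnoresNode v (fixFirst X a b d)
  fixFirst-ignores ignores a b d VI≈ VS≈ coin≈ =
    ignores (agreeOff-suc a VI≈) (agreeOff-suc b VS≈) (agreeOff-suc d coin≈)

E-factor : ∀ {n} {p : JointLaw n} {q} → Normalised p q → ∀ v f X → IgnoresNode v X →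
           E p q (λ VI VS coin → f (VI v) (VS v) (coin v) * X VI VS coin) ≡ nodeMean p q v f * E p q X
E-factor {suc m} {p} {q} normalised zero f X ignores =
  trans (E-first f) (cong (nodeMean p q zero f *_) (begin
    E tail₀ q X₀
      ≡⟨ ≡.sym (*-identityˡ _) ⟩
    1ℚ * E tail₀ q X₀
      ≡⟨ cong (_* E tail₀ q X₀) (≡.sym (normalised zero)) ⟩
    nodeMean p q zero (λ _ _ _ → 1ℚ) * E tail₀ q X₀
      ≡⟨ ≡.sym (E-first λ _ _ _ → 1ℚ) ⟩
    E p q (λ VI VS coin → 1ℚ * X VI VS coin)
      ≡⟨ E-cong p q (λ VI VS coin → *-identityˡ _) ⟩
    E p q X  ∎))
  where
  open ≡-Reasoning
  tail₀ = tailLaw p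
  X₀ = fixFirst X false false false
  E-first : ∀ g → E p q (λ VI VS coin → g (VI zero) (VS zero) (coin zero) * X VI VS coin)
                    ≡ nodeMean p q zero g * E tail₀ q X₀
  E-first g = begin
    E p q (λ VI VS coin → g (VI zero) (VS zero) (coin zero) * X VI VS coin)
      ≡⟨ E-peel p q _ ⟩
    (∑𝔹³ λ a b d → nodeWeight p q zero a b d * E tail₀ q (λ VI VS coin → g a b d * fixFirst X a b d VI VS coin))
      ≡⟨ ∑𝔹³-cong (λ a b d → cong (nodeWeight p q zero a b d *_) (trans
           (E-cong tail₀ q λ VI VS coin → cong (g a b d *_) (fixFirst-ignored ignores a b d VI VS coin))
           (E-*ˡ tail₀ q (g a b d) X₀))) ⟩
    (∑𝔹³ λ a b d → nodeWeight p q zero a b d * (g a b d * E tail₀ q X₀))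
      ≡⟨ ∑𝔹³-cong (λ a b d → ≡.sym (*-assoc (nodeWeight p q zero a b d) (g a b d) (E tail₀ q X₀))) ⟩
    (∑𝔹³ λ a b d → nodeWeight p q zero a b d * g a b d * E tail₀ q X₀)
      ≡⟨ ∑𝔹³-*ʳ (E tail₀ q X₀) (λ a b d → nodeWeight p q zero a b d * g a b d) ⟩
    nodeMean p q zero g * E tail₀ q X₀  ∎
E-factor {suc m} {p} {q} normalised (suc v) f X ignores = begin
  E p q (λ VI VS coin → f (VI (suc v)) (VS (suc v)) (coin (suc v)) * X VI VS coin)
    ≡⟨ E-peel p q _ ⟩
  (∑𝔹³ λ a b d → nodeWeight p q zero a b d *
     E (tailLaw p) q (λ VI VS coin → f (VI v) (VS v) (coin v) * fixFirst X a b d VI VS coin))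
    ≡⟨ ∑𝔹³-cong (λ a b d → cong (nodeWeight p q zero a b d *_)
         (E-factor {p = tailLaw p} {q} (normalised ∘ suc) v f (fixFirst X a b d) (fixFirst-ignores ignores a b d))) ⟩
  (∑𝔹³ λ a b d → nodeWeight p q zero a b d * (μ * E (tailLaw p) q (fixFirst X a b d)))
    ≡⟨ ∑𝔹³-cong (λ a b d →
         *-Props.x∙yz≈y∙xz (nodeWeight p q zero a b d) μ (E (tailLaw p) q (fixFirst X a b d))) ⟩
  (∑𝔹³ λ a b d → μ * (nodeWeight p q zero a b d * E (tailLaw p) q (fixFirst X a b d)))
    ≡⟨ ∑𝔹³-*ˡ μ (λ a b d → nodeWeight p q zero a b d * E (tailLaw p) q (fixFirst X a b d)) ⟩
  μ * (∑𝔹³ λ a b d → nodeWeight p q zero a b d * E (tailLaw p) q (fixFirst X a b d))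
    ≡⟨ cong (μ *_) (≡.sym (E-peel p q X)) ⟩
  μ * E p q X  ∎
  where
  open ≡-Reasoning
  μ = nodeMean p q (suc v) f

module _ {n} (p : JointLaw n) (q : ℚ) (v : Fin n) where

  pairMean : (Bool → Bool → ℚ) → ℚ
  pairMean g = ∑𝔹 λ a → ∑𝔹 λ b → p v a b * g a b

  coinMean : (Bool → ℚ) → ℚ
  coinMean h = ∑𝔹 λ d → coinWeight q d * h d

  nodeMean-separable : ∀ g h → nodeMean p q v (λ a b d → g a b * h d) ≡ pairMean g * coinMean h
  nodeMean-separable g h = begin
    (∑𝔹³ λ a b d → p v a b * coinWeight q d * (g a b * h d))
      ≡⟨ ∑𝔹³-cong (λ a b d → *-Props.interchange (p v a b) (coinWeight q d) (g a b) (h d)) ⟩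
    (∑𝔹³ λ a b d → p v a b * g a b * (coinWeight q d * h d))
      ≡⟨ ∑𝔹-cong (λ a → ∑𝔹-cong λ b → ∑𝔹-*ˡ (p v a b * g a b) λ d → coinWeight q d * h d) ⟩
    (∑𝔹 λ a → ∑𝔹 λ b → p v a b * g a b * coinMean h)
      ≡⟨ ∑𝔹-cong (λ a → ∑𝔹-*ʳ (coinMean h) λ b → p v a b * g a b) ⟩
    (∑𝔹 λ a → (∑𝔹 λ b → p v a b * g a b) * coinMean h)
      ≡⟨ ∑𝔹-*ʳ (coinMean h) (λ a → ∑𝔹 λ b → p v a b * g a b) ⟩
    pairMean g * coinMean h  ∎
    where open ≡-Reasoning

  pairMean-VI : pairMean (λ a _ → 𝟙 a) ≡ PrI p v
  pairMean-VI = solve 4 (λ x y z w → (x :* con 0ℚ :+ y :* con 0ℚ) :+ (z :* con 1ℚ :+ w :* con 1ℚ) := z :+ w)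
    refl (p v false false) (p v false true) (p v true false) (p v true true)

  pairMean-VS : pairMean (λ _ b → 𝟙 b) ≡ PrS p v
  pairMean-VS = solve 4 (λ x y z w → (x :* con 0ℚ :+ y :* con 1ℚ) :+ (z :* con 0ℚ :+ w :* con 1ℚ) := y :+ w)
    refl (p v false false) (p v false true) (p v true false) (p v true true)

  pairMean-1 : p v false false + p v false true + p v true false + p v true true ≡ 1ℚ → pairMean (λ _ _ → 1ℚ) ≡ 1ℚ
  pairMean-1 = trans (solve 4
    (λ x y z w → (x :* con 1ℚ :+ y :* con 1ℚ) :+ (z :* con 1ℚ :+ w :* con 1ℚ) := x :+ y :+ z :+ w)
    refl (p v false false) (p v false true) (p v true false) (p v true true))

  coinMean-coin : coinMean 𝟙 ≡ q
  coinMean-coin = solve 2 (λ r q → r :* con 0ℚ :+ q :* con 1ℚ := q) refl (1ℚ - q) q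

  coinMean-1 : coinMean (λ _ → 1ℚ) ≡ 1ℚ
  coinMean-1 = solve 1 (λ q → (con 1ℚ :- q) :* con 1ℚ :+ q :* con 1ℚ := con 1ℚ) refl q

module _ {n} {p : JointLaw n} {q : ℚ} where

  nodeMean-VI∧coin : ∀ v → nodeMean p q v (λ a _ d → 𝟙 a * 𝟙 d) ≡ PrI p v * q
  nodeMean-VI∧coin v = trans (nodeMean-separable p q v (λ a _ → 𝟙 a) 𝟙)
                             (cong₂ _*_ (pairMean-VI p q v) (coinMean-coin p q v))

  nodeMean-VS : ∀ v → nodeMean p q v (λ _ b _ → 𝟙 b) ≡ PrS p v
  nodeMean-VS v = begin
    nodeMean p q v (λ _ b _ → 𝟙 b)
      ≡⟨ ∑𝔹³-cong (λ a b d → cong (nodeWeight p q v a b d *_) (≡.sym (*-identityʳ (𝟙 b)))) ⟩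
    nodeMean p q v (λ _ b _ → 𝟙 b * 1ℚ)
      ≡⟨ nodeMean-separable p q v (λ _ b → 𝟙 b) (λ _ → 1ℚ) ⟩
    pairMean p q v (λ _ b → 𝟙 b) * coinMean p q v (λ _ → 1ℚ)
      ≡⟨ cong₂ _*_ (pairMean-VS p q v) (coinMean-1 p q v) ⟩
    PrS p v * 1ℚ
      ≡⟨ *-identityʳ (PrS p v) ⟩
    PrS p v  ∎
    where open ≡-Reasoning

  total⇒normalised : (∀ v → p v false false + p v false true + p v true false + p v true true ≡ 1ℚ) → Normalised p q
  total⇒normalised total v = trans (nodeMean-separable p q v (λ _ _ → 1ℚ) (λ _ → 1ℚ))
                                   (cong₂ _*_ (pairMean-1 p q v (total v)) (coinMean-1 p q v))

  E-exchange : ∀ {c} → NonNegativeWeights p q → Normalised p q → 0ℚ ≤ q →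
    ∀ v → PrI p v ≤ c * PrS p v →
    ∀ Y → (∀ VI VS coin → 0ℚ ≤ Y VI VS coin) → IgnoresNode v Y →
    E p q (λ VI VS coin → 𝟙 (VI v) * 𝟙 (coin v) * Y VI VS coin)
      ≤ c * q * E p q (λ VI VS coin → 𝟙 (VS v) * Y VI VS coin)
  E-exchange {c} 0≤w normalised 0≤q v PrI≤cPrS Y 0≤Y ignores = begin
    E p q (λ VI VS coin → 𝟙 (VI v) * 𝟙 (coin v) * Y VI VS coin)
      ≡⟨ E-factor {p = p} {q} normalised v (λ a _ d → 𝟙 a * 𝟙 d) Y ignores ⟩
    nodeMean p q v (λ a _ d → 𝟙 a * 𝟙 d) * E p q Y
      ≡⟨ cong (_* E p q Y) (nodeMean-VI∧coin v) ⟩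
    PrI p v * q * E p q Y
      ≤⟨ *-monoʳ-≤-0≤ (E-nonNeg {p = p} {q} 0≤w 0≤Y) (*-monoʳ-≤-0≤ 0≤q PrI≤cPrS) ⟩
    c * PrS p v * q * E p q Y
      ≡⟨ solve 4 (λ c s q e → c :* s :* q :* e := c :* q :* (s :* e)) refl c (PrS p v) q (E p q Y) ⟩
    c * q * (PrS p v * E p q Y)
      ≡⟨ cong (c * q *_) (≡.sym (trans (E-factor {p = p} {q} normalised v (λ _ b _ → 𝟙 b) Y ignores)
                                        (cong (_* E p q Y) (nodeMean-VS v)))) ⟩
    c * q * E p q (λ VI VS coin → 𝟙 (VS v) * Y VI VS coin)  ∎
    where open ≤-Reasoning

≺⇒< : ∀ {n} {u v : Fin n} → T (u ≺ v) → u < v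
≺⇒< {u = u} {v} = ℕ.<ᵇ⇒< (toℕ u) (toℕ v)

<⇒≺ : ∀ {n} {u v : Fin n} → u < v → T (u ≺ v)
<⇒≺ = ℕ.<⇒<ᵇ

any-false : ∀ {P : A → Bool} {xs x} → T (not (any P xs)) → x ∈ xs → P x ≡ false
any-false {P = P} {x = x} none x∈xs with P x in Px
... | false = refl
... | true  = ⊥-elim (subst T (Equivalence.to T-not-≡ none) (any⁺ P (lose x∈xs (subst T (≡.sym Px) tt))))

T-ext : ∀ {a b} → (T a → T b) → (T b → T a) → a ≡ b
T-ext a⇒b b⇒a = ⇔→≡ (mk⇔ (Equivalence.to T-≡ ∘ a⇒b ∘ Equivalence.from T-≡)
                         (Equivalence.to T-≡ ∘ b⇒a ∘ Equivalence.from T-≡))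

allFin-sorted : ∀ n → AllPairs _<_ (allFin n)
allFin-sorted n = tabulate⁺-< id

module Greedy {n} (G : Graph n) (VS : Subset n) where

  Accepts : List (Fin n) → Fin n → Bool
  Accepts chosen x = VS x ∧ not (any (λ u → adj G u x) chosen)

  step : List (Fin n) → Fin n → List (Fin n)
  step chosen x = if Accepts chosen x then x ∷ chosen else chosen

  run : List (Fin n) → List (Fin n) → List (Fin n)
  run = foldl step

  step-⊇ : ∀ chosen x {y} → y ∈ chosen → y ∈ step chosen x
  step-⊇ chosen x y∈chosen with Accepts chosen x
  ... | true  = there y∈chosen
  ... | false = y∈chosen

  step-accepts : ∀ chosen x → T (Accepts chosen x) → x ∈ step chosen x
  step-accepts chosen x accepted with Accepts chosen x
  ... | true = here refl

  step-∈ : ∀ chosen x {y} → y ∈ step chosen x → y ∈ chosen ⊎ (y ≡ x × T (Accepts chosen x))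
  step-∈ chosen x y∈ with Accepts chosen x
  step-∈ chosen x (here y≡x)    | true  = inj₂ (y≡x , tt)
  step-∈ chosen x (there y∈chosen) | true  = inj₁ y∈chosen
  step-∈ chosen x y∈chosen         | false = inj₁ y∈chosen

  accepted-or-blocked : ∀ chosen {x} → T (VS x) → T (Accepts chosen x) ⊎ T (any (λ u → adj G u x) chosen)
  accepted-or-blocked chosen {x} VSx with any (λ u → adj G u x) chosen
  ... | true  = inj₂ tt
  ... | false = inj₁ (Equivalence.from T-∧ (VSx , tt))

  run-⊇ : ∀ xs {chosen y} → y ∈ chosen → y ∈ run chosen xs
  run-⊇ []       y∈chosen = y∈chosen
  run-⊇ (x ∷ xs) {chosen} y∈chosen = run-⊇ xs (step-⊇ chosen x y∈chosen)

  run-sound : ∀ xs {chosen y} → y ∈ run chosen xs → y ∈ chosen ⊎ T (VS y)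
  run-sound []       y∈ = inj₁ y∈
  run-sound (x ∷ xs) {chosen} y∈ with run-sound xs y∈
  ... | inj₂ VSy = inj₂ VSy
  ... | inj₁ y∈step with step-∈ chosen x y∈step
  ...   | inj₁ y∈chosen           = inj₁ y∈chosen
  ...   | inj₂ (refl , accepted) = inj₂ (proj₁ (Equivalence.to T-∧ accepted))

  NonAdjacent : List (Fin n) → Set
  NonAdjacent chosen = ∀ {x y} → x ∈ chosen → y ∈ chosen → adj G x y ≡ false

  accepted-nonAdjacent : ∀ {chosen x} → T (Accepts chosen x) → ∀ {u} → u ∈ chosen → adj G u x ≡ false
  accepted-nonAdjacent accepted = any-false (proj₂ (Equivalence.to T-∧ accepted))

  step-nonAdjacent : ∀ chosen x → NonAdjacent chosen → NonAdjacent (step chosen x)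
  step-nonAdjacent chosen x indep y∈ z∈ with step-∈ chosen x y∈ | step-∈ chosen x z∈
  ... | inj₁ y∈chosen             | inj₁ z∈chosen             = indep y∈chosen z∈chosen
  ... | inj₂ (refl , _)        | inj₂ (refl , _)        = irrefl G x
  ... | inj₁ y∈chosen             | inj₂ (refl , accepted) = accepted-nonAdjacent accepted y∈chosen
  ... | inj₂ (refl , accepted) | inj₁ z∈chosen             =
    trans (Graph.sym G x _) (accepted-nonAdjacent accepted z∈chosen)

  run-nonAdjacent : ∀ xs {chosen} → NonAdjacent chosen → NonAdjacent (run chosen xs)
  run-nonAdjacent []       indep = indep
  run-nonAdjacent (x ∷ xs) {chosen} indep = run-nonAdjacent xs (step-nonAdjacent chosen x indep)

  Below : List (Fin n) → List (Fin n) → Set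
  Below chosen xs = ∀ {a} → a ∈ chosen → All (a <_) xs

  run-complete : ∀ xs {chosen v} → AllPairs _<_ xs → Below chosen xs → v ∈ xs → T (VS v) → v ∉ run chosen xs →
                 ∃[ u ] u ∈ run chosen xs × u < v × T (adj G u v)
  run-complete (v ∷ xs) {chosen} _ below (here refl) VSv v∉ with accepted-or-blocked chosen VSv
  ... | inj₁ accepted = contradiction (run-⊇ xs (step-accepts chosen v accepted)) v∉
  ... | inj₂ blocked with find (any⁻ _ chosen blocked)
  ...   | u , u∈chosen , adj-uv = u , run-⊇ xs (step-⊇ chosen v u∈chosen) , All.head (below u∈chosen) , adj-uv
  run-complete (x ∷ xs) {chosen} (x<xs ∷ sorted) below (there v∈xs) VSv v∉ =
    run-complete xs sorted below′ v∈xs VSv v∉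
    where
    below′ : Below (step chosen x) xs
    below′ a∈ with step-∈ chosen x a∈
    ... | inj₁ a∈chosen      = All.tail (below a∈chosen)
    ... | inj₂ (refl , _) = x<xs

module _ {n} (G : Graph n) where

  open Greedy G

  -- M₂ G VS VI v unfolds to VI v ∧ Unblocked G VS v.
  Unblocked : Subset n → Fin n → Bool
  Unblocked VS v = not (any (λ u → M₁ G VS u ∧ (u ≺ v) ∧ adj G u v) (allFin n))

  ∈⇒M₁ : ∀ {VS v} → v ∈ greedyList G VS → T (M₁ G VS v)
  ∈⇒M₁ v∈ = any⁺ _ (Any.map (λ v≡u → fromWitness (≡.sym v≡u)) v∈)

  M₁⇒∈ : ∀ {VS v} → T (M₁ G VS v) → v ∈ greedyList G VS
  M₁⇒∈ {VS} v∈M₁ = Any.map (λ u≟v → ≡.sym (toWitness u≟v)) (any⁻ _ (greedyList G VS) v∈M₁)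

  M₁-⊆ : ∀ {VS v} → T (M₁ G VS v) → T (VS v)
  M₁-⊆ {VS} v∈M₁ with run-sound VS (allFin n) (M₁⇒∈ v∈M₁)
  ... | inj₂ VSv = VSv

  M₁-nonAdjacent : ∀ {VS u v} → T (M₁ G VS u) → T (M₁ G VS v) → adj G u v ≡ false
  M₁-nonAdjacent {VS} u∈M₁ v∈M₁ = run-nonAdjacent VS (allFin n) (λ ()) (M₁⇒∈ u∈M₁) (M₁⇒∈ v∈M₁)

  M₁-independent : ∀ VS → Independent G (M₁ G VS)
  M₁-independent VS u v u∈M₁ v∈M₁ = M₁-nonAdjacent (Equivalence.from T-≡ u∈M₁) (Equivalence.from T-≡ v∈M₁)

  M₁-unblocked : ∀ {VS v} → T (M₁ G VS v) → T (Unblocked VS v)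
  M₁-unblocked {VS} {v} v∈M₁ with any (λ u → M₁ G VS u ∧ (u ≺ v) ∧ adj G u v) (allFin n) in blocked
  ... | false = tt
  ... | true with find (any⁻ _ (allFin n) (subst T (≡.sym blocked) tt))
  ...   | u , _ , u∈M₁∧u≺v∧uv with Equivalence.to T-∧ u∈M₁∧u≺v∧uv
  ...     | u∈M₁ , u≺v∧uv = subst T (M₁-nonAdjacent u∈M₁ v∈M₁) (proj₂ (Equivalence.to T-∧ u≺v∧uv))

  M₁-complete : ∀ {VS v} → T (VS v) → T (Unblocked VS v) → T (M₁ G VS v)
  M₁-complete {VS} {v} VSv unblocked with M₁ G VS v in v∈M₁
  ... | true  = tt
  ... | false with run-complete VS (allFin n) (allFin-sorted n) (λ ()) (∈-allFin v) VSv
                                (λ v∈ → subst T v∈M₁ (∈⇒M₁ v∈))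
  ...   | u , u∈ , u<v , uv = subst T (Equivalence.to T-not-≡ unblocked)
            (any⁺ _ (lose (∈-allFin u) (Equivalence.from T-∧ (∈⇒M₁ u∈ , Equivalence.from T-∧ (<⇒≺ u<v , uv)))))

  M₁-unfold : ∀ VS v → M₁ G VS v ≡ VS v ∧ Unblocked VS v
  M₁-unfold VS v = T-ext
    (λ v∈M₁ → Equivalence.from T-∧ (M₁-⊆ v∈M₁ , M₁-unblocked v∈M₁))
    (λ VSv∧unblocked → let VSv , unblocked = Equivalence.to T-∧ VSv∧unblocked in M₁-complete VSv unblocked)

  Unblocked-local : ∀ {VS VS′ t} → (∀ {u} → u < t → M₁ G VS u ≡ M₁ G VS′ u) →
                    Unblocked VS t ≡ Unblocked VS′ t
  Unblocked-local {VS} {VS′} {t} agree = cong (not ∘ or) (List.map-cong agreeAt (allFin n))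
    where
    agreeAt : ∀ u → (M₁ G VS u ∧ (u ≺ t) ∧ adj G u t) ≡ (M₁ G VS′ u ∧ (u ≺ t) ∧ adj G u t)
    agreeAt u with u ≺ t in u≺t
    ... | true  = cong (_∧ adj G u t) (agree (≺⇒< (subst T (≡.sym u≺t) tt)))
    ... | false = trans (∧-zeroʳ (M₁ G VS u)) (≡.sym (∧-zeroʳ (M₁ G VS′ u)))

  module _ {v : Fin n} {VS VS′ : Subset n} (VS≈ : AgreeOff v VS VS′) where

    M₁-agreeOff : ∀ {w} → w < v → M₁ G VS w ≡ M₁ G VS′ w
    M₁-agreeOff {w} = go w (<-wellFounded w)
      where
      go : ∀ w → Acc _<_ w → w < v → M₁ G VS w ≡ M₁ G VS′ w
      go w (acc smaller) w<v = begin
        M₁ G VS w               ≡⟨ M₁-unfold VS w ⟩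
        VS w ∧ Unblocked VS w   ≡⟨ cong₂ _∧_ (VS≈ w (Finₚ.<⇒≢ w<v))
                                     (Unblocked-local λ u<w → go _ (smaller u<w) (Finₚ.<-trans u<w w<v)) ⟩
        VS′ w ∧ Unblocked VS′ w ≡⟨ M₁-unfold VS′ w ⟨
        M₁ G VS′ w              ∎
        where open ≡-Reasoning

    Unblocked-agreeOff : ∀ {t} → t Fin.≤ v → Unblocked VS t ≡ Unblocked VS′ t
    Unblocked-agreeOff t≤v = Unblocked-local λ u<t → M₁-agreeOff (ℕ.<-≤-trans u<t t≤v)

module _ {n} (G : Graph n) where

  inC : Fin n → Fin n → RandomVar n
  inC u v VI VS coin = 𝟙 ((u ≺ v) ∧ adj G u v ∧ M₃ G VS VI coin u ∧ M₃ G VS VI coin v)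

  chargedTo : Fin n → Fin n → RandomVar n
  chargedTo u v VI VS coin = 𝟙 (M₃ G VS VI coin u) * 𝟙 (M₁ G VS v ∧ (u ≺ v) ∧ adj G v u)

  sizeC-∑ : ∀ VI VS coin → ℕtoℚ (sizeC G VS VI coin) ≡ ∑ (allFin n) λ v → ∑ (allFin n) λ u → inC u v VI VS coin
  sizeC-∑ VI VS coin = trans (ℕtoℚ-sum (allFin n) _) (∑-cong (allFin n) λ v →
    ℕtoℚ-count λ u → (u ≺ v) ∧ adj G u v ∧ M₃ G VS VI coin u ∧ M₃ G VS VI coin v)

  charges-≤ : ∀ {ρ} → InductivelyIndependent G ρ → ∀ VI VS coin →
    (∑ (allFin n) λ v → ∑ (allFin n) λ u → chargedTo u v VI VS coin) ≤ ℕtoℚ ρ * ℕtoℚ (sizeM₃ G VS VI coin)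
  charges-≤ {ρ} indInd VI VS coin = begin
    (∑ V λ v → ∑ V λ u → chargedTo u v VI VS coin)
      ≡⟨ ∑-swap V V (λ v u → chargedTo u v VI VS coin) ⟩
    (∑ V λ u → ∑ V λ v → 𝟙 (M₃ G VS VI coin u) * 𝟙 (laterM₁Neighbour u v))
      ≡⟨ ∑-cong V (λ u → ∑-*ˡ V (𝟙 (M₃ G VS VI coin u)) (𝟙 ∘ laterM₁Neighbour u)) ⟩
    (∑ V λ u → 𝟙 (M₃ G VS VI coin u) * ∑ V λ v → 𝟙 (laterM₁Neighbour u v))
      ≡⟨ ∑-cong V (λ u → cong (𝟙 (M₃ G VS VI coin u) *_) (≡.sym (ℕtoℚ-count (laterM₁Neighbour u)))) ⟩
    (∑ V λ u → 𝟙 (M₃ G VS VI coin u) * ℕtoℚ (count (laterM₁Neighbour u)))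
      ≤⟨ ∑-mono V (λ u → *-monoˡ-≤-0≤ (𝟙-nonNeg (M₃ G VS VI coin u))
                            (ℕtoℚ-mono-≤ (indInd (M₁ G VS) (M₁-independent G VS) u))) ⟩
    (∑ V λ u → 𝟙 (M₃ G VS VI coin u) * ℕtoℚ ρ)
      ≡⟨ ∑-cong V (λ u → *-comm _ (ℕtoℚ ρ)) ⟩
    (∑ V λ u → ℕtoℚ ρ * 𝟙 (M₃ G VS VI coin u))
      ≡⟨ ∑-*ˡ V (ℕtoℚ ρ) (𝟙 ∘ M₃ G VS VI coin) ⟩
    ℕtoℚ ρ * ∑ V (𝟙 ∘ M₃ G VS VI coin)
      ≡⟨ cong (ℕtoℚ ρ *_) (≡.sym (ℕtoℚ-count (M₃ G VS VI coin))) ⟩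
    ℕtoℚ ρ * ℕtoℚ (sizeM₃ G VS VI coin)  ∎
    where
    open ≤-Reasoning
    V = allFin n
    laterM₁Neighbour : Fin n → Fin n → Bool
    laterM₁Neighbour u v = M₁ G VS v ∧ (u ≺ v) ∧ adj G v u

  M₃-unblocked : Fin n → Fin n → RandomVar n
  M₃-unblocked u v VI VS coin = 𝟙 (M₃ G VS VI coin u ∧ Unblocked G VS v)

  -- Both u ∈ M₃ and whether v is blocked are decided by the nodes other than v, since u ≺ v.
  M₃-unblocked-ignores : ∀ {u v} → u < v → IgnoresNode v (M₃-unblocked u v)
  M₃-unblocked-ignores {u} u<v VI≈ VS≈ coin≈ = cong 𝟙 (cong₂ _∧_
    (cong₂ _∧_ (cong₂ _∧_ (VI≈ u u≢v) (Unblocked-agreeOff G VS≈ (ℕ.<⇒≤ u<v))) (coin≈ u u≢v))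
    (Unblocked-agreeOff G VS≈ ℕ.≤-refl))
    where u≢v = Finₚ.<⇒≢ u<v

  inC-split : ∀ {u v} → T (u ≺ v) → T (adj G u v) →
    ∀ VI VS coin → inC u v VI VS coin ≡ 𝟙 (VI v) * 𝟙 (coin v) * M₃-unblocked u v VI VS coin
  inC-split {u} {v} u≺v uv VI VS coin = begin
    𝟙 ((u ≺ v) ∧ adj G u v ∧ m₃ ∧ (VI v ∧ unblocked) ∧ coin v)
      ≡⟨ cong₂ (λ a b → 𝟙 (a ∧ b ∧ m₃ ∧ (VI v ∧ unblocked) ∧ coin v))
               (Equivalence.to T-≡ u≺v) (Equivalence.to T-≡ uv) ⟩
    𝟙 (m₃ ∧ (VI v ∧ unblocked) ∧ coin v)
      ≡⟨ cong (λ b → 𝟙 (m₃ ∧ b)) (∧-Props.xy∙z≈xz∙y (VI v) unblocked (coin v)) ⟩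
    𝟙 (m₃ ∧ (VI v ∧ coin v) ∧ unblocked)
      ≡⟨ cong 𝟙 (∧-Props.x∙yz≈y∙xz m₃ (VI v ∧ coin v) unblocked) ⟩
    𝟙 ((VI v ∧ coin v) ∧ m₃ ∧ unblocked)
      ≡⟨ trans (𝟙-∧ (VI v ∧ coin v) _) (cong (_* 𝟙 (m₃ ∧ unblocked)) (𝟙-∧ (VI v) (coin v))) ⟩
    𝟙 (VI v) * 𝟙 (coin v) * 𝟙 (m₃ ∧ unblocked)  ∎
    where
    open ≡-Reasoning
    m₃ = M₃ G VS VI coin u
    unblocked = Unblocked G VS v

  chargedTo-merge : ∀ {u v} → T (u ≺ v) → T (adj G u v) →
    ∀ VI VS coin → 𝟙 (VS v) * M₃-unblocked u v VI VS coin ≡ chargedTo u v VI VS coin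
  chargedTo-merge {u} {v} u≺v uv VI VS coin = begin
    𝟙 (VS v) * 𝟙 (m₃ ∧ Unblocked G VS v)
      ≡⟨ ≡.sym (𝟙-∧ (VS v) _) ⟩
    𝟙 (VS v ∧ m₃ ∧ Unblocked G VS v)
      ≡⟨ cong 𝟙 (∧-Props.x∙yz≈y∙xz (VS v) m₃ _) ⟩
    𝟙 (m₃ ∧ VS v ∧ Unblocked G VS v)
      ≡⟨ cong (λ b → 𝟙 (m₃ ∧ b)) (≡.sym (M₁-unfold G VS v)) ⟩
    𝟙 (m₃ ∧ M₁ G VS v)
      ≡⟨ 𝟙-∧ m₃ _ ⟩
    𝟙 m₃ * 𝟙 (M₁ G VS v)
      ≡⟨ cong (λ b → 𝟙 m₃ * 𝟙 b)
              (trans (≡.sym (∧-identityʳ (M₁ G VS v))) (cong (M₁ G VS v ∧_) (≡.sym laterNeighbour))) ⟩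
    𝟙 m₃ * 𝟙 (M₁ G VS v ∧ (u ≺ v) ∧ adj G v u)  ∎
    where
    open ≡-Reasoning
    m₃ = M₃ G VS VI coin u
    laterNeighbour : (u ≺ v) ∧ adj G v u ≡ true
    laterNeighbour = Equivalence.to T-≡ (Equivalence.from T-∧ (u≺v , subst T (Graph.sym G u v) uv))

module _ {n} (G : Graph n) {p : JointLaw n} {q c : ℚ}
         (0≤w : NonNegativeWeights p q) (normalised : Normalised p q) (0≤q : 0ℚ ≤ q) (0≤c : 0ℚ ≤ c)
         (PrI≤cPrS : ∀ v → PrI p v ≤ c * PrS p v) where

  E-inC≤-edge : ∀ {u v} → T (u ≺ v) → T (adj G u v) → E p q (inC G u v) ≤ c * q * E p q (chargedTo G u v)
  E-inC≤-edge {u} {v} u≺v uv = begin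
    E p q (inC G u v)
      ≡⟨ E-cong p q (inC-split G u≺v uv) ⟩
    E p q (λ VI VS coin → 𝟙 (VI v) * 𝟙 (coin v) * M₃-unblocked G u v VI VS coin)
      ≤⟨ E-exchange {p = p} {q} {c} 0≤w normalised 0≤q v (PrI≤cPrS v) (M₃-unblocked G u v)
                    (λ VI VS coin → 𝟙-nonNeg (M₃ G VS VI coin u ∧ Unblocked G VS v))
                    (M₃-unblocked-ignores G (≺⇒< u≺v)) ⟩
    c * q * E p q (λ VI VS coin → 𝟙 (VS v) * M₃-unblocked G u v VI VS coin)
      ≡⟨ cong (c * q *_) (E-cong p q (chargedTo-merge G u≺v uv)) ⟩
    c * q * E p q (chargedTo G u v)  ∎
    where open ≤-Reasoning

  E-inC≤ : ∀ u v → E p q (inC G u v) ≤ c * q * E p q (chargedTo G u v)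
  E-inC≤ u v with (u ≺ v) ∧ adj G u v in edge
  ... | true  = let u≺v , uv = Equivalence.to T-∧ (subst T (≡.sym edge) tt) in E-inC≤-edge u≺v uv
  ... | false = begin
    E p q (inC G u v)
      ≡⟨ E-cong p q (λ VI VS coin → cong 𝟙 (trans (≡.sym (∧-assoc (u ≺ v) (adj G u v) _))
                                                  (cong (_∧ (M₃ G VS VI coin u ∧ M₃ G VS VI coin v)) edge))) ⟩
    E p q (λ _ _ _ → 0ℚ)
      ≡⟨ E-0 p q ⟩
    0ℚ
      ≤⟨ *-nonNeg (*-nonNeg 0≤c 0≤q) (E-nonNeg {p = p} {q} 0≤w λ VI VS coin →
           *-nonNeg (𝟙-nonNeg (M₃ G VS VI coin u)) (𝟙-nonNeg (M₁ G VS v ∧ (u ≺ v) ∧ adj G v u))) ⟩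
    c * q * E p q (chargedTo G u v)  ∎
    where open ≤-Reasoning

  E-sizeC≤ : E p q (λ VI VS coin → ℕtoℚ (sizeC G VS VI coin))
             ≤ c * q * E p q (λ VI VS coin → ∑ (allFin n) λ v → ∑ (allFin n) λ u → chargedTo G u v VI VS coin)
  E-sizeC≤ = begin
    E p q (λ VI VS coin → ℕtoℚ (sizeC G VS VI coin))
      ≡⟨ trans (E-cong p q (sizeC-∑ G)) (E-∑² p q V V λ v u → inC G u v) ⟩
    (∑ V λ v → ∑ V λ u → E p q (inC G u v))
      ≤⟨ ∑-mono V (λ v → ∑-mono V λ u → E-inC≤ u v) ⟩
    (∑ V λ v → ∑ V λ u → c * q * E p q (chargedTo G u v))
      ≡⟨ trans (∑²-*ˡ V V (c * q) λ v u → E p q (chargedTo G u v))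
               (cong (c * q *_) (≡.sym (E-∑² p q V V λ v u → chargedTo G u v))) ⟩
    c * q * E p q (λ VI VS coin → ∑ V λ v → ∑ V λ u → chargedTo G u v VI VS coin)  ∎
    where
    open ≤-Reasoning
    V = allFin n

lemma5 : ∀ {n} (G : Graph n) (ρ : ℕ) → 1 Data.Nat.≤ ρ → InductivelyIndependent G ρ →
  (c : ℚ) → 1ℚ ≤ c →
  (p : JointLaw n) →
  (∀ v a b → 0ℚ ≤ p v a b) →
  (∀ v → p v false false + p v false true + p v true false + p v true true ≡ 1ℚ) →
  (∀ v → PrS p v ≤ c * PrI p v) →
  (∀ v → PrI p v ≤ c * PrS p v) →
  (q : ℚ) → q * ((ℕtoℚ 2 * ℕtoℚ ρ) * c) ≡ 1ℚ →
  𝔼 p q (λ VI VS coin → sizeC G VS VI coin)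
    ≤ q * ℕtoℚ ρ * c * 𝔼 p q (λ VI VS coin → sizeM₃ G VS VI coin)
lemma5 {n} G ρ 1≤ρ indInd c 1≤c p 0≤p total _ PrI≤cPrS q q·2ρc≡1 = begin
  𝔼 p q (λ VI VS coin → sizeC G VS VI coin)
    ≡⟨ 𝔼≡E p q (λ VI VS coin → sizeC G VS VI coin) ⟩
  E p q (λ VI VS coin → ℕtoℚ (sizeC G VS VI coin))
    ≤⟨ E-sizeC≤ G {p} {q} {c} 0≤w normalised 0≤q 0≤c PrI≤cPrS ⟩
  c * q * E p q (λ VI VS coin → ∑ (allFin n) λ v → ∑ (allFin n) λ u → chargedTo G u v VI VS coin)
    ≤⟨ *-monoˡ-≤-0≤ (*-nonNeg 0≤c 0≤q) (E-mono {p = p} {q} 0≤w (charges-≤ G indInd)) ⟩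
  c * q * E p q (λ VI VS coin → ℕtoℚ ρ * ℕtoℚ (sizeM₃ G VS VI coin))
    ≡⟨ cong (c * q *_) (E-*ˡ p q (ℕtoℚ ρ) λ VI VS coin → ℕtoℚ (sizeM₃ G VS VI coin)) ⟩
  c * q * (ℕtoℚ ρ * 𝔼M₃)
    ≡⟨ solve 4 (λ c q r e → c :* q :* (r :* e) := q :* r :* c :* e) refl c q (ℕtoℚ ρ) 𝔼M₃ ⟩
  q * ℕtoℚ ρ * c * 𝔼M₃
    ≡⟨ cong (q * ℕtoℚ ρ * c *_) (≡.sym (𝔼≡E p q λ VI VS coin → sizeM₃ G VS VI coin)) ⟩
  q * ℕtoℚ ρ * c * 𝔼 p q (λ VI VS coin → sizeM₃ G VS VI coin)  ∎
  where
  open ≤-Reasoning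
  𝔼M₃ = E p q (λ VI VS coin → ℕtoℚ (sizeM₃ G VS VI coin))
  1≤2ρc : 1ℚ ≤ ℕtoℚ 2 * ℕtoℚ ρ * c
  1≤2ρc = 1≤* (1≤* (ℕtoℚ-mono-≤ {1} {2} (ℕ.s≤s ℕ.z≤n)) (ℕtoℚ-mono-≤ 1≤ρ)) 1≤c
  0≤q = inverse-nonNeg 1≤2ρc q·2ρc≡1
  normalised : Normalised p q
  normalised = total⇒normalised {p = p} {q} total
  0≤c = ≤-trans 0≤1 1≤c
  0≤w : NonNegativeWeights p q
  0≤w = nodeWeight-nonNeg 0≤p 0≤q (inverse-≤1 1≤2ρc q·2ρc≡1)
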